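{- Let $L$ be a language that includes a (unary) function symbol $p$, and let $X$ be a finite set of $L$-terms with variables $x_1,\ldots,x_n$. If $T$ is an $X$-template, then there exists a quantifier-free $L$-formula $\xi_T(x_1,\ldots,x_n)$ such that for every rooted forest $F$, every $L$-structure $S$ guarded by the closure of $F$ such that the interpretation $p^S$ is the $F$-parent function, and every $n$-tuple $v_1,\ldots,v_n\in V(S)$, we have $S\models\xi_T(v_1,\ldots,v_n)$ if and only if $v_1,\ldots,v_n$ are compatible with $T$, $F$ and $S$.
   Context: A language $L$ has finitely many relation symbols (with arities) and finitely many unary function symbols; an $L$-structure $S$ has a finite domain $V(S)$, relations $R^S$ and functions $f^S$. $L$-terms are variables or $f(t)$ for a function symbol $f$ and term $t$. The Gaifman graph of $S$ has vertex set $V(S)$, distinct $a,b$ adjacent iff they occur together in a tuple of a relation or one is the image of the other under some $f^S$; $S$ is guarded by a graph $G$ if $V(G)=V(S)$ and the Gaifman graph is a subgraph of $G$. A rooted forest is a digraph whose weak components are out-branchings; depth of a vertex = number of vertices on the path from its root to it. A subforest of $F$ is a subgraph containing, with each of its vertices $v$, the path from the root of $v$'s tree to $v$. The closure of $F$ is the undirected graph on $V(F)$ joining distinct vertices connected by a directed path in $F$. The $F$-parent function maps each non-root vertex to its parent and each root to itself. An $X$-template is a rooted forest $T$ with a map $\alpha_T:X\to V(T)$ such that every vertex of $T$ without descendants is in the image of $\alpha_T$. An embedding of $T$ in $F$ is a map $\nu:V(T)\to V(F)$ sending roots of $T$ to roots of $F$ that is an isomorphism of $T$ onto the subforest of $F$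 with vertex set $\nu(V(T))$; it is $(v_1,\ldots,v_n)$-admissible for $S$ if $\nu(\alpha_T(t))=t(v_1,\ldots,v_n)$ (value of $t$ in $S$ with $x_i\mapsto v_i$) for all $t\in X$; $v_1,\ldots,v_n$ are compatible with $T,F,S$ if such an embedding exists. -}

module Defs where

open import Data.Nat using (ℕ; zero; suc)
open import Data.Fin using (Fin)
open import Data.Maybe using (Maybe; just; nothing; maybe)
open import Data.Bool using (Bool; true)
open import Data.Product using (Σ; ∃; ∃-syntax; _×_; _,_)
open import Data.Sum using (_⊎_)
open import Data.Empty using (⊥)
open import Data.Unit using (⊤)
open import Function using (id)
open import Function.Definitions using (Injective)
open import Function.Bundles using (_⇔_)
open import Relation.Nullary using (¬_)
open import Relation.Binary.PropositionalEquality using (_≡_; _≢_)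

record Language : Set where
  field
    nRel  : ℕ
    arity : Fin nRel → ℕ
    nFun  : ℕ

RelSym : Language → Set
RelSym L = Fin (Language.nRel L)

FunSym : Language → Set
FunSym L = Fin (Language.nFun L)

record Structure (L : Language) (N : ℕ) : Set where
  field
    rel : (r : RelSym L) → (Fin (Language.arity L r) → Fin N) → Bool
    fun : FunSym L → Fin N → Fin N

data Term (L : Language) (n : ℕ) : Set where
  var : Fin n → Term L n
  app : FunSym L → Term L n → Term L n

eval : ∀ {L n N} → Structure L N → (Fin n → Fin N) → Term L n → Fin N
eval S vs (var i)   = vs i
eval S vs (app f t) = Structure.fun S f (eval S vs t)

data QFFormula (L : Language) (n : ℕ) : Set where
  tt  : QFFormula L n
  ff  : QFFormula L n
  _≐_ : Term L n → Term L n → QFFormula L n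
  atom : (r : RelSym L) → (Fin (Language.arity L r) → Term L n) → QFFormula L n
  ¬ᶠ_  : QFFormula L n → QFFormula L n
  _∧ᶠ_ : QFFormula L n → QFFormula L n → QFFormula L n
  _∨ᶠ_ : QFFormula L n → QFFormula L n → QFFormula L n

_⊨_[_] : ∀ {L n N} → Structure L N → QFFormula L n → (Fin n → Fin N) → Set
S ⊨ tt [ vs ] = ⊤
S ⊨ ff [ vs ] = ⊥
S ⊨ (t ≐ u) [ vs ] = eval S vs t ≡ eval S vs u
S ⊨ atom r ts [ vs ] = Structure.rel S r (λ j → eval S vs (ts j)) ≡ true
S ⊨ (¬ᶠ φ) [ vs ] = ¬ (S ⊨ φ [ vs ])
S ⊨ (φ ∧ᶠ ψ) [ vs ] = (S ⊨ φ [ vs ]) × (S ⊨ ψ [ vs ])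
S ⊨ (φ ∨ᶠ ψ) [ vs ] = (S ⊨ φ [ vs ]) ⊎ (S ⊨ ψ [ vs ])

-- A digraph whose weak components are out-branchings is the same as a
-- digraph in which every vertex has at most one in-neighbour (its parent)
-- and there are no directed cycles.  We encode the arcs by the partial
-- parent map: there is an arc u → v iff parent v ≡ just u.

iterParent : ∀ {m} → (Fin m → Maybe (Fin m)) → ℕ → Fin m → Maybe (Fin m)
iterParent par zero    v = just v
iterParent par (suc k) v = maybe (iterParent par k) nothing (par v)

record RootedForest (m : ℕ) : Set where
  field
    parent  : Fin m → Maybe (Fin m)
    acyclic : ∀ v → ∃[ k ] iterParent parent k v ≡ nothing

module _ {m : ℕ} (F : RootedForest m) where
  open RootedForest F

  Arc : Fin m → Fin m → Set
  Arc u v = parent v ≡ just u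

  IsRoot : Fin m → Set
  IsRoot v = parent v ≡ nothing

  DPath : Fin m → Fin m → Set
  DPath a b = ∃[ k ] iterParent parent k b ≡ just a

  ClosureAdj : Fin m → Fin m → Set
  ClosureAdj a b = a ≢ b × (DPath a b ⊎ DPath b a)

  parentFun : Fin m → Fin m
  parentFun v = maybe id v (parent v)

  IsLeaf : Fin m → Set
  IsLeaf v = ¬ (∃[ w ] Arc v w)

GaifmanAdj : ∀ {L N} → Structure L N → Fin N → Fin N → Set
GaifmanAdj {L} {N} S a b =
  a ≢ b ×
  ( (Σ (RelSym L) λ r → Σ (Fin (Language.arity L r) → Fin N) λ tup →
       Structure.rel S r tup ≡ true × ∃[ i ] ∃[ j ] (tup i ≡ a × tup j ≡ b))
  ⊎ (∃[ f ] (Structure.fun S f a ≡ b ⊎ Structure.fun S f b ≡ a)))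

GuardedByClosure : ∀ {L N} → Structure L N → RootedForest N → Set
GuardedByClosure {N = N} S F = ∀ (a b : Fin N) → GaifmanAdj S a b → ClosureAdj F a b

-- X-templates, for a finite set X of terms given by an injective
-- enumeration X : Fin k → Term L n.

record Template {L : Language} {n k : ℕ} (X : Fin k → Term L n) : Set where
  field
    size   : ℕ
    forest : RootedForest size
    α      : Fin k → Fin size
    leaves : ∀ v → IsLeaf forest v → ∃[ i ] α i ≡ v

-- Embeddings of a rooted forest T (on Fin m) in F (on Fin N):
-- ν maps roots to roots and is an isomorphism of T onto the subforest of
-- F with vertex set ν(V(T)) (this vertex set must be closed under taking
-- F-parents, and the subforest is then the induced subgraph).

record IsEmbedding {m N : ℕ} (T : RootedForest m) (F : RootedForest N)
                   (ν : Fin m → Fin N) : Set where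
  field
    injective   : Injective _≡_ _≡_ ν
    rootsToRoots : ∀ u → IsRoot T u → IsRoot F (ν u)
    downClosed  : ∀ u y → Arc F y (ν u) → ∃[ w ] ν w ≡ y
    arcs        : ∀ u w → Arc T u w ⇔ Arc F (ν u) (ν w)

Admissible : ∀ {L n k N} {X : Fin k → Term L n} → (T : Template X) →
             Structure L N → (Fin n → Fin N) →
             (Fin (Template.size T) → Fin N) → Set
Admissible {X = X} T S vs ν = ∀ i → ν (Template.α T i) ≡ eval S vs (X i)

Compatible : ∀ {L n k N} {X : Fin k → Term L n} → (T : Template X) →
             RootedForest N → Structure L N → (Fin n → Fin N) → Set
Compatible {N = N} T F S vs =
  Σ (Fin (Template.size T) → Fin N) λ ν →
    IsEmbedding (Template.forest T) F ν × Admissible T S vs ν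

-- Descending through children from any template vertex must end at a leaf (the forest is
-- finite and acyclic), and leaves are labelled, so every vertex u is the d-th ancestor of
-- some α(i). Since p is the parent function, an admissible embedding has to send u to the
-- value of the term p^d(X i). Hence compatibility is the quantifier-free condition that
-- these canonical values are distinct for distinct vertices, agree with X on the labels,
-- and are mapped by p as the template's parent function maps the vertices; for then the
-- canonical map is injective and commutes with the parent functions, which already makes
-- it an embedding.
module Submission where

open import Defs
open import Data.Nat using (ℕ; zero; suc; _+_; _*_; _≤_)
open import Data.Nat.GeneralisedArithmetic using (iterate)
open import Data.Nat.Properties using (+-suc; m≤m*n; m≤n⇒∃[o]m+o≡n; n<1+n)
open import Data.Fin using (Fin; zero; suc; toℕ)
open import Data.Fin.Properties using (_≟_; any?; pigeonhole; toℕ≤pred[n])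
open import Data.Maybe using (Maybe; just; nothing; maybe)
open import Data.Maybe.Properties using (just-injective; ≡-dec)
open import Data.Product using (Σ; ∃-syntax; _,_; proj₁; proj₂)
open import Data.Sum using (_⊎_; inj₁; inj₂)
open import Data.Empty using (⊥-elim)
open import Data.Unit using (tt)
open import Function using (id)
open import Function.Bundles using (_⇔_; mk⇔; Equivalence)
open import Function.Definitions using (Injective)
open import Relation.Nullary using (¬_; Dec; yes; no)
open import Relation.Binary.PropositionalEquality

iterate-natural : ∀ {a b} {A : Set a} {B : Set b} {f : A → A} {g : B → B} (h : A → B) →
                  (∀ x → h (f x) ≡ g (h x)) → ∀ x d → h (iterate f x d) ≡ iterate g (h x) d
iterate-natural h comm x zero    = refl
iterate-natural {g = g} h comm x (suc d) =
  trans (iterate-natural h comm _ d) (cong (λ y → iterate g y d) (comm x))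

module _ {m : ℕ} (par : Fin m → Maybe (Fin m)) where

  iterParent-+ : ∀ a b v → iterParent par (a + b) v ≡ maybe (iterParent par b) nothing (iterParent par a v)
  iterParent-+ zero    b v = refl
  iterParent-+ (suc a) b v with par v
  ... | nothing = refl
  ... | just w  = iterParent-+ a b w

  iterParent-nothing-mono : ∀ {s t} v → s ≤ t → iterParent par s v ≡ nothing → iterParent par t v ≡ nothing
  iterParent-nothing-mono {s} v s≤t e with m≤n⇒∃[o]m+o≡n s≤t
  ... | o , refl rewrite iterParent-+ s o v | e = refl

  iterParent-step : ∀ d {v w x} → iterParent par d v ≡ just w → par w ≡ just x → iterParent par (suc d) v ≡ just x
  iterParent-step zero    refl e rewrite e = refl
  iterParent-step (suc d) {v} e e′ with par v
  ... | just u = iterParent-step d e e′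

  iterParent-periodic : ∀ d v → iterParent par d v ≡ just v → ∀ q → iterParent par (q * d) v ≡ just v
  iterParent-periodic d v e zero    = refl
  iterParent-periodic d v e (suc q) rewrite iterParent-+ d (q * d) v | e = iterParent-periodic d v e q

module _ {m : ℕ} (F : RootedForest m) where
  open RootedForest F

  parentFun-arc : ∀ {u v} → Arc F u v → parentFun F v ≡ u
  parentFun-arc {v = v} e = cong (maybe id v) e

  parentFun-root : ∀ {v} → IsRoot F v → parentFun F v ≡ v
  parentFun-root {v} e = cong (maybe id v) e

  -- A cycle through v repeats forever, so no iterate of the parent map from v is undefined.
  iterParent-acyclic : ∀ d v → iterParent parent (suc d) v ≢ just v
  iterParent-acyclic d v cycle with acyclic v
  ... | k , undefined with trans (sym (iterParent-periodic parent (suc d) v cycle k))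
                                 (iterParent-nothing-mono parent v (m≤m*n k (suc d)) undefined)
  ... | ()

  parent≢self : ∀ v → ¬ Arc F v v
  parent≢self v e = iterParent-acyclic 0 v (cong (maybe just nothing) e)

  parentFun-fixed⇒root : ∀ {v} → parentFun F v ≡ v → IsRoot F v
  parentFun-fixed⇒root {v} e with parent v in eq
  ... | nothing = refl
  ... | just w  = ⊥-elim (parent≢self v (trans eq (cong just e)))

  parentFun-moved⇒arc : ∀ {v} → parentFun F v ≢ v → Arc F (parentFun F v) v
  parentFun-moved⇒arc {v} ne with parent v
  ... | nothing = ⊥-elim (ne refl)
  ... | just w  = refl

  iterParent⇒iterate : ∀ d {v u} → iterParent parent d v ≡ just u → iterate (parentFun F) v d ≡ u
  iterParent⇒iterate zero    e = just-injective e
  iterParent⇒iterate (suc d) {v} e with parent v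
  ... | just w = iterParent⇒iterate d e

  -- The m + 1 ancestors of v at distance 0, …, m cannot all be distinct vertices.
  iterParent-size : ∀ v → iterParent parent m v ≡ nothing
  iterParent-size v with iterParent parent m v in defined
  ... | nothing = refl
  ... | just _ with pigeonhole (n<1+n m) (λ s → iterate (parentFun F) v (toℕ s))
  ... | i , j , i<j , same with m≤n⇒∃[o]m+o≡n i<j
  ... | o , i+1+o≡j = ⊥-elim (iterParent-acyclic o z cycle)
    where
    open ≡-Reasoning
    ancestor : ∀ (s : Fin (suc m)) → iterParent parent (toℕ s) v ≡ just (iterate (parentFun F) v (toℕ s))
    ancestor s with iterParent parent (toℕ s) v in e
    ... | just y = cong just (sym (iterParent⇒iterate (toℕ s) e))
    ... | nothing with trans (sym defined) (iterParent-nothing-mono parent v (toℕ≤pred[n] s) e)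
    ... | ()
    z = iterate (parentFun F) v (toℕ i)
    cycle : iterParent parent (suc o) z ≡ just z
    cycle = begin
      iterParent parent (suc o) z
        ≡⟨ cong (maybe (iterParent parent (suc o)) nothing) (sym (ancestor i)) ⟩
      maybe (iterParent parent (suc o)) nothing (iterParent parent (toℕ i) v)
        ≡⟨ sym (iterParent-+ parent (toℕ i) (suc o) v) ⟩
      iterParent parent (toℕ i + suc o) v
        ≡⟨ cong (λ t → iterParent parent t v) (trans (+-suc (toℕ i) o) i+1+o≡j) ⟩
      iterParent parent (toℕ j) v
        ≡⟨ ancestor j ⟩
      just (iterate (parentFun F) v (toℕ j))
        ≡⟨ cong just (sym same) ⟩
      just z ∎

module _ {m k : ℕ} (F : RootedForest m) (α : Fin k → Fin m)
         (leafCover : ∀ v → IsLeaf F v → ∃[ i ] α i ≡ v) where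
  open RootedForest F

  private
    LabelAncestor : Fin m → Set
    LabelAncestor x = ∃[ i ] ∃[ d ] iterParent parent d (α i) ≡ just x

    descend : ∀ j x → LabelAncestor x ⊎ ∃[ y ] iterParent parent j y ≡ just x
    descend zero    x = inj₂ (x , refl)
    descend (suc j) x with any? (λ w → ≡-dec _≟_ (parent w) (just x))
    ... | no leaf = let i , αi≡x = leafCover x leaf in inj₁ (i , 0 , cong just αi≡x)
    ... | yes (w , arc) with descend j w
    ...   | inj₁ (i , d , e) = inj₁ (i , suc d , iterParent-step parent d e arc)
    ...   | inj₂ (y , e)     = inj₂ (y , iterParent-step parent j e arc)

  -- A descending path of length m would exceed the depth bound, so descent always meets a label.
  ancestorOfLabel : ∀ x → ∃[ i ] ∃[ d ] iterate (parentFun F) (α i) d ≡ x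
  ancestorOfLabel x with descend m x
  ... | inj₁ (i , d , e) = i , d , iterParent⇒iterate F d e
  ... | inj₂ (y , e) with trans (sym (iterParent-size F y)) e
  ... | ()

module _ {m N : ℕ} {T : RootedForest m} {F : RootedForest N} {ν : Fin m → Fin N} where

  embedding⇒parentFun-commute : IsEmbedding T F ν → ∀ u → parentFun F (ν u) ≡ ν (parentFun T u)
  embedding⇒parentFun-commute emb u with RootedForest.parent T u in eq
  ... | nothing = parentFun-root F (IsEmbedding.rootsToRoots emb u eq)
  ... | just u′ = parentFun-arc F (Equivalence.to (IsEmbedding.arcs emb u′ u) eq)

  parentFun-commute⇒embedding : Injective _≡_ _≡_ ν → (∀ u → parentFun F (ν u) ≡ ν (parentFun T u)) →
                                IsEmbedding T F ν
  parentFun-commute⇒embedding inj commute = record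
    { injective    = inj
    ; rootsToRoots = roots
    ; downClosed   = λ u y e → parentFun T u , trans (sym (commute u)) (parentFun-arc F e)
    ; arcs         = λ u w → mk⇔ (arc⇒ u w) (arc⇐ u w)
    }
    where
    roots : ∀ u → IsRoot T u → IsRoot F (ν u)
    roots u e = parentFun-fixed⇒root F (trans (commute u) (cong ν (parentFun-root T e)))

    arc⇒ : ∀ u w → Arc T u w → Arc F (ν u) (ν w)
    arc⇒ u w e = subst (λ x → Arc F x (ν w)) imageOfParent (parentFun-moved⇒arc F moved)
      where
      imageOfParent : parentFun F (ν w) ≡ ν u
      imageOfParent = trans (commute w) (cong ν (parentFun-arc T e))
      moved : parentFun F (ν w) ≢ ν w
      moved fixed = parent≢self T u (subst (Arc T u) (sym (inj (trans (sym imageOfParent) fixed))) e)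

    arc⇐ : ∀ u w → Arc F (ν u) (ν w) → Arc T u w
    arc⇐ u w e with RootedForest.parent T w in eq
    ... | nothing with trans (sym (roots w eq)) e
    ...   | ()
    arc⇐ u w e | just u′ = cong just (inj (just-injective (trans (sym (arc⇒ u′ w eq)) e)))

⋀ : ∀ {L n m} → (Fin m → QFFormula L n) → QFFormula L n
⋀ {m = zero}  φ = tt
⋀ {m = suc m} φ = φ zero ∧ᶠ ⋀ (λ i → φ (suc i))

⊨-⋀ : ∀ {L n N m} {S : Structure L N} {vs : Fin n → Fin N} {φ : Fin m → QFFormula L n} →
      (S ⊨ ⋀ φ [ vs ]) ⇔ (∀ i → S ⊨ φ i [ vs ])
⊨-⋀ = mk⇔ elim intro
  where
  elim : ∀ {m} {φ} → _ ⊨ ⋀ {m = m} φ [ _ ] → ∀ i → _ ⊨ φ i [ _ ]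
  elim (holds , _)    zero    = holds
  elim (_ , holdsRest) (suc i) = elim holdsRest i
  intro : ∀ {m} {φ} → (∀ i → _ ⊨ φ i [ _ ]) → _ ⊨ ⋀ {m = m} φ [ _ ]
  intro {zero}  h = tt
  intro {suc m} h = h zero , intro (λ i → h (suc i))

module CanonicalFormula {L : Language} (p : FunSym L) {n k : ℕ} {X : Fin k → Term L n}
                        (T : Template X) where
  open Template T

  canonicalTerm : Fin size → Term L n
  canonicalTerm u = let i , d , _ = ancestorOfLabel forest α leaves u in iterate (app p) (X i) d

  distinctness : (u w : Fin size) → Dec (u ≡ w) → QFFormula L n
  distinctness u w (yes _) = tt
  distinctness u w (no _)  = ¬ᶠ (canonicalTerm u ≐ canonicalTerm w)

  ξ : QFFormula L n
  ξ = ⋀ (λ u → ⋀ (λ w → distinctness u w (u ≟ w)))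
      ∧ᶠ (⋀ (λ i → canonicalTerm (α i) ≐ X i)
      ∧ᶠ ⋀ (λ u → app p (canonicalTerm u) ≐ canonicalTerm (parentFun forest u)))

  module _ {N : ℕ} (F : RootedForest N) (S : Structure L N)
           (p-parent : ∀ v → Structure.fun S p v ≡ parentFun F v) (vs : Fin n → Fin N) where

    canonicalMap : Fin size → Fin N
    canonicalMap u = eval S vs (canonicalTerm u)

    ⊨-distinctness : ∀ u w d → (S ⊨ distinctness u w d [ vs ]) ⇔ (canonicalMap u ≡ canonicalMap w → u ≡ w)
    ⊨-distinctness u w (yes u≡w) = mk⇔ (λ _ _ → u≡w) (λ _ → tt)
    ⊨-distinctness u w (no u≢w)  = mk⇔ (λ distinct same → ⊥-elim (distinct same)) (λ inj same → u≢w (inj same))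

    compatible⇒canonical : ∀ {ν} → IsEmbedding forest F ν → Admissible T S vs ν → ∀ u → ν u ≡ canonicalMap u
    compatible⇒canonical {ν} emb admissible u = begin
      ν u                                           ≡⟨ cong ν (sym αi↑d≡u) ⟩
      ν (iterate (parentFun forest) (α i) d)         ≡⟨ iterate-natural ν (λ w → sym (embedding⇒parentFun-commute emb w)) (α i) d ⟩
      iterate (parentFun F) (ν (α i)) d              ≡⟨ cong (λ v → iterate (parentFun F) v d) (admissible i) ⟩
      iterate (parentFun F) (eval S vs (X i)) d      ≡⟨ sym (iterate-natural id p-parent (eval S vs (X i)) d) ⟩
      iterate (Structure.fun S p) (eval S vs (X i)) d ≡⟨ sym (iterate-natural (eval S vs) (λ _ → refl) (X i) d) ⟩
      canonicalMap u                                ∎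
      where
      open ≡-Reasoning
      i = proj₁ (ancestorOfLabel forest α leaves u)
      d = proj₁ (proj₂ (ancestorOfLabel forest α leaves u))
      αi↑d≡u = proj₂ (proj₂ (ancestorOfLabel forest α leaves u))

    ⊨ξ⇔compatible : (S ⊨ ξ [ vs ]) ⇔ Compatible T F S vs
    ⊨ξ⇔compatible = mk⇔ sound complete
      where
      open Equivalence

      sound : S ⊨ ξ [ vs ] → Compatible T F S vs
      sound (distinct , labelled , parentEqs) =
        canonicalMap , parentFun-commute⇒embedding injective commute , to ⊨-⋀ labelled
        where
        injective : Injective _≡_ _≡_ canonicalMap
        injective {u} {w} = to (⊨-distinctness u w (u ≟ w)) (to ⊨-⋀ (to ⊨-⋀ distinct u) w)
        commute : ∀ u → parentFun F (canonicalMap u) ≡ canonicalMap (parentFun forest u)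
        commute u = trans (sym (p-parent _)) (to ⊨-⋀ parentEqs u)

      complete : Compatible T F S vs → S ⊨ ξ [ vs ]
      complete (ν , emb , admissible) =
        from ⊨-⋀ (λ u → from ⊨-⋀ λ w → from (⊨-distinctness u w (u ≟ w)) (injective u w)) ,
        (from ⊨-⋀ (λ i → trans (sym (canonical (α i))) (admissible i)) ,
         from ⊨-⋀ parentEq)
        where
        canonical = compatible⇒canonical emb admissible
        injective : ∀ u w → canonicalMap u ≡ canonicalMap w → u ≡ w
        injective u w same = IsEmbedding.injective emb (trans (canonical u) (trans same (sym (canonical w))))
        parentEq : ∀ u → Structure.fun S p (canonicalMap u) ≡ canonicalMap (parentFun forest u)
        parentEq u = begin
          Structure.fun S p (canonicalMap u) ≡⟨ p-parent _ ⟩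
          parentFun F (canonicalMap u)       ≡⟨ cong (parentFun F) (sym (canonical u)) ⟩
          parentFun F (ν u)                  ≡⟨ embedding⇒parentFun-commute emb u ⟩
          ν (parentFun forest u)             ≡⟨ canonical (parentFun forest u) ⟩
          canonicalMap (parentFun forest u)  ∎
          where open ≡-Reasoning

lemma15 : (L : Language) (p : FunSym L) (n k : ℕ)
          (X : Fin k → Term L n) → Injective _≡_ _≡_ X →
          (T : Template X) →
          Σ (QFFormula L n) λ ξ →
            ∀ (N : ℕ) (F : RootedForest N) (S : Structure L N) →
            GuardedByClosure S F →
            (∀ v → Structure.fun S p v ≡ parentFun F v) →
            (vs : Fin n → Fin N) →
            ((S ⊨ ξ [ vs ]) ⇔ Compatible T F S vs)
lemma15 L p n k X _ T = ξ , λ N F S _ p-parent vs → ⊨ξ⇔compatible F S p-parent vs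
  where open CanonicalFormula p T
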